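{- Let $\sigma=\langle\Theta;\mathbf{K}A,\Gamma\Rightarrow\Delta\rangle$ be an ordinary sequent such that $\Delta\subseteq\mathrm{At}$, every formula in the second compartment $\{\mathbf{K}A\}\cup\Gamma$ is either a propositional variable or a formula of the form $\mathbf{K}C$, and the second and third compartments have empty intersection. Let $\mathcal{K}=\langle S,\rho,\leq,E,\Vdash\rangle$ with $S=\{\rho\}$, $\leq=\{(\rho,\rho)\}$, $E=\emptyset$, and $\rho\Vdash p$ for a variable $p$ iff $p\in\Gamma\cap\mathrm{V}$. Then $\mathcal{K}$ is a Kripke model for $\mathbf{IEL}^-$ and its root $\rho$ satisfies $\sigma$.
   Context: Formulas: $\mathrm{V}$ is a denumerable set of propositional variables, $\mathrm{At}=\mathrm{V}\cup\{\bot\}$, formulas are built from $\mathrm{At}$ with $\land,\lor,\to$ and unary $\mathbf{K}$. Kripke models for $\mathbf{IEL}^-$: $\langle S,\rho,\leq,E,\Vdash\rangle$ where $S$ is nonempty, $\leq$ is a partial order on $S$ with least element $\rho$ (root), and $E\subseteq S\times S$ satisfies (Im1) $\alpha E\beta$ implies $\alpha\leq\beta$, and (Im2) $\alpha\leq\beta$ and $\beta E\gamma$ imply $\alpha E\gamma$ (no seriality condition is required). Forcing is defined from a $\leq$-persistent valuation of variables by: $\alpha\nVdash\bot$; usual clauses for $\land,\lor$; $\alpha\Vdash B\to C$ iff every $\beta\geq\alpha$ has $\beta\nVdash B$ or $\beta\Vdash C$; $\alpha\Vdash\mathbf{K}B$ iff every $\beta$ with $\alpha E\beta$ forces $B$.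 Sequents: for finite sets of formulas $\Theta,\Gamma,\Delta$ (first, second, third compartment), $\langle\Theta;\Gamma\Rightarrow\Delta\rangle$; a world $\alpha$ satisfies it iff $\alpha$ forces every formula of $\Gamma$, forces no formula of $\Delta$, and every $\beta$ with $\alpha\leq\beta$, $\alpha\neq\beta$ forces every formula of $\Theta$. The notation $\langle\Theta;\mathbf{K}A,\Gamma\Rightarrow\Delta\rangle$ means the second compartment is $\{\mathbf{K}A\}\cup\Gamma$. -}

module Defs where

open import Data.Nat using (ℕ)
open import Data.Unit using (⊤; tt)
open import Data.Empty using (⊥)
open import Data.Product using (_×_; Σ)
open import Data.Sum using (_⊎_)
open import Data.List using (List; _∷_)
open import Data.List.Membership.Propositional using (_∈_)
open import Relation.Nullary using (¬_)
open import Relation.Binary.PropositionalEquality using (_≡_)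
open import Relation.Binary.Structures using (IsPartialOrder)

-- Propositional variables: V = ℕ (denumerable).  At = V ∪ {⊥}.
data Fm : Set where
  var  : ℕ → Fm
  falsum : Fm
  _∧′_ _∨′_ _⇒_ : Fm → Fm → Fm
  K    : Fm → Fm

IsAtom : Fm → Set
IsAtom (var _) = ⊤
IsAtom falsum  = ⊤
IsAtom _       = ⊥

IsVarOrK : Fm → Set
IsVarOrK (var _) = ⊤
IsVarOrK (K _)   = ⊤
IsVarOrK _       = ⊥

record Structure : Set₁ where
  field
    S    : Set
    root : S
    _≤_  : S → S → Set
    E    : S → S → Set
    val  : S → ℕ → Set

record IsIELminusModel (M : Structure) : Set where
  open Structure M
  field
    partialOrder : IsPartialOrder _≡_ _≤_
    rootLeast    : ∀ α → root ≤ α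
    Im1          : ∀ {α β} → E α β → α ≤ β
    Im2          : ∀ {α β γ} → α ≤ β → E β γ → E α γ
    persistent   : ∀ {α β} p → α ≤ β → val α p → val β p

module _ (M : Structure) where
  open Structure M

  _⊩_ : S → Fm → Set
  α ⊩ var p    = val α p
  α ⊩ falsum   = ⊥
  α ⊩ (B ∧′ C) = (α ⊩ B) × (α ⊩ C)
  α ⊩ (B ∨′ C) = (α ⊩ B) ⊎ (α ⊩ C)
  α ⊩ (B ⇒ C)  = ∀ β → α ≤ β → β ⊩ B → β ⊩ C
  α ⊩ K B      = ∀ β → E α β → β ⊩ B

  -- satisfaction of the sequent ⟨Θ ; Γ ⇒ Δ⟩ (finite sets as lists)
  Satisfies : S → List Fm → List Fm → List Fm → Set
  Satisfies α Θ Γ Δ =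
    (∀ F → F ∈ Γ → α ⊩ F) ×
    (∀ F → F ∈ Δ → ¬ (α ⊩ F)) ×
    (∀ β → α ≤ β → ¬ (α ≡ β) → ∀ F → F ∈ Θ → β ⊩ F)

onePoint : List Fm → Structure
onePoint Γ = record
  { S    = ⊤
  ; root = tt
  ; _≤_  = λ _ _ → ⊤
  ; E    = λ _ _ → ⊥
  ; val  = λ _ p → var p ∈ Γ
  }

module Submission where

open import Defs
open import Data.Empty using (⊥; ⊥-elim)
open import Data.Unit using (⊤; tt)
open import Data.Product using (_×_; _,_)
open import Data.List using (List; _∷_)
open import Data.List.Membership.Propositional using (_∈_)
open import Data.List.Relation.Unary.All using (All; lookup)
open import Data.List.Relation.Unary.Any using (here; there)
open import Relation.Binary.PropositionalEquality using (_≡_; refl; isEquivalence)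
open import Relation.Binary.Structures using (IsPartialOrder)
open import Relation.Nullary using (¬_)

⊤-total-isPartialOrder : IsPartialOrder {A = ⊤} _≡_ (λ _ _ → ⊤)
⊤-total-isPartialOrder = record
  { isPreorder = record
    { isEquivalence = isEquivalence
    ; reflexive     = λ _ → tt
    ; trans         = λ _ _ → tt
    }
  ; antisym = λ _ _ → refl
  }

onePoint-isIELminusModel : (Γ : List Fm) → IsIELminusModel (onePoint Γ)
onePoint-isIELminusModel Γ = record
  { partialOrder = ⊤-total-isPartialOrder
  ; rootLeast    = λ _ → tt
  ; Im1          = λ ()
  ; Im2          = λ _ ()
  ; persistent   = λ _ _ v → v
  }

module _ (Γ : List Fm) where
  open Structure (onePoint Γ) using (root)

  private
    _⊩′_ : ⊤ → Fm → Set
    _⊩′_ = _⊩_ (onePoint Γ)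

  onePoint-⊩-K : ∀ C → root ⊩′ K C
  onePoint-⊩-K C _ ()

  onePoint-⊩-varOrK : ∀ {F} → IsVarOrK F → F ∈ Γ → root ⊩′ F
  onePoint-⊩-varOrK {var p} _ p∈Γ = p∈Γ
  onePoint-⊩-varOrK {K C}   _ _   = onePoint-⊩-K C

  onePoint-⊮-atom : ∀ {F} → IsAtom F → ¬ F ∈ Γ → ¬ root ⊩′ F
  onePoint-⊮-atom {var p}  _ p∉Γ p∈Γ = p∉Γ p∈Γ
  onePoint-⊮-atom {falsum} _ _   ()

mainTheorem4 : (Θ Γ Δ : List Fm) (A : Fm) →
    All IsAtom Δ →
    All IsVarOrK (K A ∷ Γ) →
    (∀ F → F ∈ (K A ∷ Γ) → F ∈ Δ → ⊥) →
    IsIELminusModel (onePoint Γ) ×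
    Satisfies (onePoint Γ) (Structure.root (onePoint Γ)) Θ (K A ∷ Γ) Δ
mainTheorem4 Θ Γ Δ A atomsΔ varOrK disjoint =
  onePoint-isIELminusModel Γ , forcesLeft , refutesRight , vacuousΘ
  where
  forcesLeft : ∀ F → F ∈ (K A ∷ Γ) → _⊩_ (onePoint Γ) tt F
  forcesLeft F (here refl) = onePoint-⊩-K Γ A
  forcesLeft F (there F∈Γ) = onePoint-⊩-varOrK Γ (lookup varOrK (there F∈Γ)) F∈Γ

  refutesRight : ∀ F → F ∈ Δ → ¬ _⊩_ (onePoint Γ) tt F
  refutesRight F F∈Δ =
    onePoint-⊮-atom Γ (lookup atomsΔ F∈Δ) (λ F∈Γ → disjoint F (there F∈Γ) F∈Δ)

  -- ρ is the only world, so it has no proper successor.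
  vacuousΘ : ∀ β → ⊤ → ¬ tt ≡ β → ∀ F → F ∈ Θ → _⊩_ (onePoint Γ) β F
  vacuousΘ tt _ tt≢tt = ⊥-elim (tt≢tt refl)
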